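{- Let $p,q\in\mathcal{PV}$ and $\Gamma\subseteq\mathcal{A}$. The function $solve_\phi(\mathcal{V}_M)$ is (i) positive monotonic w.r.t. $VB$ for $\phi\in\{p,\ p\wedge q,\ \langle\langle\Gamma\rangle\rangle\mathrm{X}p,\ \langle\langle\Gamma\rangle\rangle\mathrm{G}p,\ \langle\langle\Gamma\rangle\rangle p\mathrm{U}q\}$; (ii) negative monotonic w.r.t. $VB$ for $\phi=\neg p$; (iii) positive and negative monotonic w.r.t. $TB_i$ for $i\in\mathcal{A}$ if $\phi\in\{p,\neg p,p\wedge q\}$; (iv) positive monotonic w.r.t. $TB_i$ for each $i\in\Gamma$ if $\phi\in\{\langle\langle\Gamma\rangle\rangle\mathrm{X}p,\ \langle\langle\Gamma\rangle\rangle\mathrm{G}p,\ \langle\langle\Gamma\rangle\rangle p\mathrm{U}q\}$; (v) negative monotonic w.r.t. $TB_i$ for $i\in\mathcal{A}\setminus\Gamma$ if $\phi\in\{\langle\langle\Gamma\rangle\rangle\mathrm{X}p,\ \langle\langle\Gamma\rangle\rangle\mathrm{G}p,\ \langle\langle\Gamma\rangle\rangle p\mathrm{U}q\}$.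
   Context: Fix a set of agents $\mathcal{A}=\{1,\dots,n\}$, a finite set $\mathcal{PV}$ of propositional variables, and for each agent $i$ a finite set of local states $L_i=\{l_i^1,\dots,l_i^{n_i}\}$. Agent $i$ has actions $Act_i=\{a_i^1,\dots,a_i^{n_i}\}$ and a local protocol $P_i:L_i\to 2^{Act_i}$ with $P_i(l)\neq\emptyset$ for all $l$; its local transition function is $T_i(l_i^k,a_i^j)=l_i^j$, defined iff $a_i^j\in P_i(l_i^k)$. A model is $M=(St,T,V)$ with $St=L_1\times\dots\times L_n$, global actions $Act=Act_1\times\dots\times Act_n$, global transition $T(g,a)=g'$ iff $T_i(g^i,a^i)=g'^i$ for all $i$ (superscript $i$ denotes the $i$-th component), and valuation $V:St\to 2^{\mathcal{PV}}$. Encoding: $P_i$ is a Boolean $n_i\times n_i$ table (entry $(l,a)$ is $1$ iff $a\in P_i(l)$) flattened into $tb_i$; $V$ is a bit vector $vb$ of length $|St|\cdot|\mathcal{PV}|$ (entry $(g,p)$ is $1$ iff $p\in V(g)$). The model is encoded by $v_M=(tb_1,\dots,tb_n,vb)$; $\mathcal{V}_M=(TB_1,\dots,TB_n,VB)$ is the corresponding vector of Boolean variables; only vectors encoding models (each local state has at least one available action) are considered. A path from $g$ is $g_0a_0g_1a_1\dots$ with $g_0=g$, $T(g_k,a_k)=g_{k+1}$; $\pi[k]=g_k$. A strategy of agent $i$ is $\sigma_i:St\to Act_i$ with $\sigma_i(g)\in P_i(g^i)$; a joint strategy $\sigma_\Gamma$ is a tuple of strategies of agents in $\Gamma$; $out_M(g,\sigma_\Gamma)$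 is the set of paths from $g$ with $a_k^j=\sigma_j(g_k)$ for all $k$ and $j\in\Gamma$. ATL semantics: $M,g\models p$ iff $p\in V(g)$; Boolean connectives as usual; $M,g\models\langle\langle\Gamma\rangle\rangle\mathrm{X}\varphi$ iff there is $\sigma_\Gamma$ with $out_M(g,\sigma_\Gamma)\neq\emptyset$ and $M,\pi[1]\models\varphi$ for every $\pi$ in it; $M,g\models\langle\langle\Gamma\rangle\rangle\varphi_1\mathrm{U}\varphi_2$ iff there is $\sigma_\Gamma$ with nonempty outcome such that every $\pi$ in it has $i\ge0$ with $M,\pi[i]\models\varphi_2$ and $M,\pi[j]\models\varphi_1$ for $j<i$; $M,g\models\langle\langle\Gamma\rangle\rangle\mathrm{G}\varphi$ iff there is $\sigma_\Gamma$ with nonempty outcome such that $M,\pi[i]\models\varphi$ for all $i\ge0$ and all $\pi$ in it. $solve_\phi(v_M)=\{g\in St: M,g\models\phi\}$ for the model $M$ encoded by $v_M$. A set-valued function $F$ of bit vectors is positive (resp. negative) monotonic w.r.t. a set $W$ of its variables if changing any single variable of $W$ from $0$ to $1$ (resp. from $1$ to $0$), others fixed, yields a value $\supseteq$ the original value. -}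

module Defs where

open import Data.Nat using (ℕ; zero; suc; _<_)
open import Data.Fin using (Fin; zero; suc)
open import Data.Fin.Subset using (Subset; _∈_; _∉_)
open import Data.Vec using (Vec; []; _∷_; lookup)
open import Data.Bool using (Bool; true; false; not)
open import Data.Product using (Σ; ∃; _×_; _,_)
open import Relation.Binary.PropositionalEquality using (_≡_)
open import Relation.Nullary using (¬_)

-- Agents are Fin n; agent i has (lookup ns i) local states, and the same
-- number of actions (action a_i^j is identified with Fin index j).
-- Propositional variables are Fin m.

data Tuple : {n : ℕ} → Vec ℕ n → Set where
  []  : Tuple []
  _∷_ : ∀ {k n} {ks : Vec ℕ n} → Fin k → Tuple ks → Tuple (k ∷ ks)

comp : ∀ {n} {ks : Vec ℕ n} → Tuple ks → (i : Fin n) → Fin (lookup ks i)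
comp (x ∷ _)  zero    = x
comp (_ ∷ xs) (suc i) = comp xs i

St : ∀ {n} → Vec ℕ n → Set
St ns = Tuple ns

Act : ∀ {n} → Vec ℕ n → Set
Act ns = Tuple ns

-- A (candidate) encoding v_M = (tb_1,…,tb_n,vb):
--   tb i l a = entry (l,a) of the protocol table of agent i
--   vb g p   = entry (g,p) of the valuation bit vector
record Model {n : ℕ} (ns : Vec ℕ n) (m : ℕ) : Set where
  field
    tb : (i : Fin n) → Fin (lookup ns i) → Fin (lookup ns i) → Bool
    vb : St ns → Fin m → Bool
open Model public

IsModel : ∀ {n} {ns : Vec ℕ n} {m} → Model ns m → Set
IsModel {n} {ns} M = (i : Fin n) (l : Fin (lookup ns i)) → ∃ λ a → tb M i l a ≡ true

-- Global transition T(g,a) = g': T_i(g^i,a^i) = g'^i for all i, where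
-- T_i(l, a_i^j) = l_i^j, defined iff a_i^j ∈ P_i(l).
Trans : ∀ {n} {ns : Vec ℕ n} {m} → Model ns m → St ns → Act ns → St ns → Set
Trans {n} M g a g' =
  (i : Fin n) → (tb M i (comp g i) (comp a i) ≡ true) × (comp g' i ≡ comp a i)

record Path {n : ℕ} {ns : Vec ℕ n} {m : ℕ} (M : Model ns m) (g : St ns) : Set where
  field
    state  : ℕ → St ns
    action : ℕ → Act ns
    start  : state 0 ≡ g
    step   : (k : ℕ) → Trans M (state k) (action k) (state (suc k))
open Path public

JStrat : ∀ {n} {ns : Vec ℕ n} {m} → Model ns m → Subset n → Set
JStrat {n} {ns} M Γ =
  Σ ((i : Fin n) → i ∈ Γ → St ns → Fin (lookup ns i)) λ σ →
    (i : Fin n) (h : i ∈ Γ) (g : St ns) → tb M i (comp g i) (σ i h g) ≡ true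

Out : ∀ {n} {ns : Vec ℕ n} {m} {M : Model ns m} {Γ : Subset n} {g : St ns} →
      JStrat M Γ → Path M g → Set
Out {n} (σ , _) π =
  (k : ℕ) (i : Fin n) (h : _ ∈ _) → comp (action π k) i ≡ σ i h (state π k)

data Formula (n m : ℕ) : Set where
  var   : Fin m → Formula n m
  ¬'_   : Formula n m → Formula n m
  _∧'_  : Formula n m → Formula n m → Formula n m
  ⟪_⟫X_ : Subset n → Formula n m → Formula n m
  ⟪_⟫G_ : Subset n → Formula n m → Formula n m
  ⟪_⟫_U_ : Subset n → Formula n m → Formula n m → Formula n m

Sat : ∀ {n} {ns : Vec ℕ n} {m} → Model ns m → St ns → Formula n m → Set
Sat M g (var p)   = vb M g p ≡ true
Sat M g (¬' φ)    = ¬ Sat M g φ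
Sat M g (φ ∧' ψ)  = Sat M g φ × Sat M g ψ
Sat M g (⟪ Γ ⟫X φ) =
  Σ (JStrat M Γ) λ σ → (Σ (Path M g) λ π → Out σ π) ×
    ((π : Path M g) → Out σ π → Sat M (state π 1) φ)
Sat M g (⟪ Γ ⟫G φ) =
  Σ (JStrat M Γ) λ σ → (Σ (Path M g) λ π → Out σ π) ×
    ((π : Path M g) → Out σ π → (i : ℕ) → Sat M (state π i) φ)
Sat M g (⟪ Γ ⟫ φ U ψ) =
  Σ (JStrat M Γ) λ σ → (Σ (Path M g) λ π → Out σ π) ×
    ((π : Path M g) → Out σ π →
      Σ ℕ λ i → Sat M (state π i) ψ ×
        ((j : ℕ) → j < i → Sat M (state π j) φ))

solve : ∀ {n} {ns : Vec ℕ n} {m} → Formula n m → Model ns m → St ns → Set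
solve φ M g = Sat M g φ

_⊆S_ : ∀ {n} {ns : Vec ℕ n} → (St ns → Set) → (St ns → Set) → Set
A ⊆S B = ∀ g → A g → B g

VBFlip : ∀ {n} {ns : Vec ℕ n} {m} → Model ns m → Model ns m → St ns → Fin m → Bool → Set
VBFlip {n} {ns} {m} M M' g p b =
  IsModel M × IsModel M' ×
  ((i : Fin n) (l a : Fin (lookup ns i)) → tb M' i l a ≡ tb M i l a) ×
  vb M g p ≡ b × vb M' g p ≡ not b ×
  ((h : St ns) (r : Fin m) → ¬ (h ≡ g × r ≡ p) → vb M' h r ≡ vb M h r)

TBFlip : ∀ {n} {ns : Vec ℕ n} {m} → Model ns m → Model ns m →
         (i : Fin n) → Fin (lookup ns i) → Fin (lookup ns i) → Bool → Set
TBFlip {n} {ns} {m} M M' i l a b =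
  IsModel M × IsModel M' ×
  ((j : Fin n) → ¬ (j ≡ i) → (l' a' : Fin (lookup ns j)) → tb M' j l' a' ≡ tb M j l' a') ×
  ((l' a' : Fin (lookup ns i)) → ¬ (l' ≡ l × a' ≡ a) → tb M' i l' a' ≡ tb M i l' a') ×
  tb M i l a ≡ b × tb M' i l a ≡ not b ×
  ((g : St ns) (r : Fin m) → vb M' g r ≡ vb M g r)

PosMonoVB : ∀ {n} (ns : Vec ℕ n) {m} → Formula n m → Set
PosMonoVB ns {m} φ = (M M' : Model ns m) (g : St ns) (p : Fin m) →
  VBFlip M M' g p false → solve φ M ⊆S solve φ M'

NegMonoVB : ∀ {n} (ns : Vec ℕ n) {m} → Formula n m → Set
NegMonoVB ns {m} φ = (M M' : Model ns m) (g : St ns) (p : Fin m) →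
  VBFlip M M' g p true → solve φ M ⊆S solve φ M'

PosMonoTB : ∀ {n} (ns : Vec ℕ n) {m} → Formula n m → Fin n → Set
PosMonoTB ns {m} φ i = (M M' : Model ns m) (l a : Fin (lookup ns i)) →
  TBFlip M M' i l a false → solve φ M ⊆S solve φ M'

NegMonoTB : ∀ {n} (ns : Vec ℕ n) {m} → Formula n m → Fin n → Set
NegMonoTB ns {m} φ i = (M M' : Model ns m) (l a : Fin (lookup ns i)) →
  TBFlip M M' i l a true → solve φ M ⊆S solve φ M'

-- Atoms only read the
-- valuation, so they follow the direction of a VB change and ignore TB
-- changes.  For a strategic modality it suffices that the new model offers
-- the coalition at least its old options and its opponents at most theirs:
-- a winning strategy stays legal, every outcome in the new model is an
-- outcome of the same strategy in the old one, and since every local state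
-- keeps an action the outcome set stays nonempty.  A VB change leaves all
-- protocols fixed; a TB flip 0→1 only enlarges the protocol of agent i and
-- a flip 1→0 only shrinks it, which is favourable to Γ when i ∈ Γ,
-- resp. i ∉ Γ.
module Submission where

open import Defs
open import Data.Nat using (ℕ; zero; suc)
open import Data.Fin using (Fin; zero; suc; _≟_)
open import Data.Fin.Subset using (Subset; _∈_; _∉_)
open import Data.Fin.Subset.Properties using (_∈?_)
open import Data.Vec using (Vec; []; _∷_; lookup)
open import Data.Vec.Properties.WithK using ([]=-irrelevant)
open import Data.Bool using (Bool; true; false)
open import Data.Product using (Σ; _×_; _,_; proj₁; proj₂)
open import Data.Empty using (⊥-elim)
open import Relation.Binary.PropositionalEquality
  using (_≡_; _≢_; refl; sym; trans; cong; subst)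
open import Relation.Nullary using (¬_; yes; no)

tuple : ∀ {n} {ks : Vec ℕ n} → ((i : Fin n) → Fin (lookup ks i)) → Tuple ks
tuple {ks = []}    f = []
tuple {ks = _ ∷ ks} f = f zero ∷ tuple {ks = ks} (λ i → f (suc i))

comp-tuple : ∀ {n} {ks : Vec ℕ n} (f : (i : Fin n) → Fin (lookup ks i)) (i : Fin n) →
             comp (tuple {ks = ks} f) i ≡ f i
comp-tuple {ks = _ ∷ _} f zero    = refl
comp-tuple {ks = _ ∷ ks} f (suc i) = comp-tuple {ks = ks} (λ j → f (suc j)) i

update-at-false-keeps-true : ∀ {A B : Set} {x₀ : A} {y₀ : B} (f f′ : A → B → Bool) → f x₀ y₀ ≡ false →
                             ((x : A) (y : B) → ¬ (x ≡ x₀ × y ≡ y₀) → f′ x y ≡ f x y) →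
                             (x : A) (y : B) → f x y ≡ true → f′ x y ≡ true
update-at-false-keeps-true f f′ f₀≡false same x y fxy≡true = trans (same x y not-updated) fxy≡true
  where
  not-updated : ¬ (x ≡ _ × y ≡ _)
  not-updated (refl , refl) with trans (sym fxy≡true) f₀≡false
  ... | ()

module _ {n : ℕ} {ns : Vec ℕ n} {m : ℕ} where

  record _⊆ⱽ_ (M M′ : Model ns m) : Set where
    constructor mk⊆ⱽ
    field vb-⊆ : (g : St ns) (r : Fin m) → vb M g r ≡ true → vb M′ g r ≡ true
  open _⊆ⱽ_

  record _⊆ᴾ[_]_ (M : Model ns m) (j : Fin n) (M′ : Model ns m) : Set where
    constructor mk⊆ᴾ
    field tb-⊆ : (l a : Fin (lookup ns j)) → tb M j l a ≡ true → tb M′ j l a ≡ true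
  open _⊆ᴾ[_]_

  record _⊑[_]_ (M : Model ns m) (Γ : Subset n) (M′ : Model ns m) : Set where
    constructor mk⊑
    field
      coalition-⊆ : (j : Fin n) → j ∈ Γ → M ⊆ᴾ[ j ] M′
      opponents-⊇ : (j : Fin n) → j ∉ Γ → M′ ⊆ᴾ[ j ] M
  open _⊑[_]_

  record Improves (Γ : Subset n) (M M′ : Model ns m) : Set where
    constructor mkImproves
    field
      target-model : IsModel M′
      protocols    : M ⊑[ Γ ] M′
      valuations   : M ⊆ⱽ M′

  module _ {M M′ : Model ns m} where

    valuations-agree⇒⊆ⱽ : ((g : St ns) (r : Fin m) → vb M′ g r ≡ vb M g r) → M ⊆ⱽ M′ × M′ ⊆ⱽ M
    valuations-agree⇒⊆ⱽ e = mk⊆ⱽ (λ g r → trans (e g r)) , mk⊆ⱽ (λ g r → trans (sym (e g r)))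

    protocols-agree⇒⊆ᴾ : ∀ {j} → ((l a : Fin (lookup ns j)) → tb M′ j l a ≡ tb M j l a) →
                         M ⊆ᴾ[ j ] M′ × M′ ⊆ᴾ[ j ] M
    protocols-agree⇒⊆ᴾ e = mk⊆ᴾ (λ l a → trans (e l a)) , mk⊆ᴾ (λ l a → trans (sym (e l a)))

  var-mono : ∀ {M M′ : Model ns m} {p} → M ⊆ⱽ M′ → solve (var p) M ⊆S solve (var p) M′
  var-mono {p = p} M⊆M′ g = vb-⊆ M⊆M′ g p

  ¬-antitone : ∀ {M M′ : Model ns m} {φ} → solve φ M′ ⊆S solve φ M → solve (¬' φ) M ⊆S solve (¬' φ) M′
  ¬-antitone φ⊇ g ¬φ φ = ¬φ (φ⊇ g φ)

  ∧-mono : ∀ {M M′ : Model ns m} {φ φ′ ψ ψ′} → solve φ M ⊆S solve φ′ M′ → solve ψ M ⊆S solve ψ′ M′ →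
           solve (φ ∧' ψ) M ⊆S solve (φ′ ∧' ψ′) M′
  ∧-mono φ⊆ ψ⊆ g (φ , ψ) = φ⊆ g φ , ψ⊆ g ψ

  module _ {Γ : Subset n} where

    transfer-strategy : ∀ {M M′ : Model ns m} → M ⊑[ Γ ] M′ → JStrat M Γ → JStrat M′ Γ
    transfer-strategy M⊑M′ (σ , legal) = σ , λ j j∈Γ g → tb-⊆ (coalition-⊆ M⊑M′ j j∈Γ) _ _ (legal j j∈Γ g)

    module _ {M : Model ns m} (M-model : IsModel M) (σ : JStrat M Γ) (g : St ns) where

      completion : (j : Fin n) → Fin (lookup ns j)
      completion j with j ∈? Γ
      ... | yes j∈Γ = proj₁ σ j j∈Γ g
      ... | no  _   = proj₁ (M-model j (comp g j))

      completion-legal : (j : Fin n) → tb M j (comp g j) (completion j) ≡ true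
      completion-legal j with j ∈? Γ
      ... | yes j∈Γ = proj₂ σ j j∈Γ g
      ... | no  _   = proj₂ (M-model j (comp g j))

      completion-follows : (j : Fin n) (j∈Γ : j ∈ Γ) → completion j ≡ proj₁ σ j j∈Γ g
      completion-follows j j∈Γ with j ∈? Γ
      ... | yes j∈Γ′ = cong (λ h → proj₁ σ j h g) ([]=-irrelevant j∈Γ′ j∈Γ)
      ... | no  j∉Γ  = ⊥-elim (j∉Γ j∈Γ)

    outcome-nonempty : ∀ {M : Model ns m} → IsModel M → (σ : JStrat M Γ) (g : St ns) → Σ (Path M g) (Out σ)
    outcome-nonempty {M} M-model σ g = π , λ k j j∈Γ →
        trans (comp-tuple {ks = ns} (choice k) j) (completion-follows {M = M} M-model σ (states k) j j∈Γ)
      where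
      states : ℕ → St ns
      choice : (k : ℕ) (j : Fin n) → Fin (lookup ns j)
      choice k = completion {M = M} M-model σ (states k)
      states zero    = g
      states (suc k) = tuple {ks = ns} (choice k)

      π : Path M g
      π = record
        { state  = states
        ; action = λ k → tuple {ks = ns} (choice k)
        ; start  = refl
        ; step   = λ k j → subst (λ a → tb M j (comp (states k) j) a ≡ true) (sym (comp-tuple {ks = ns} (choice k) j))
                                 (completion-legal {M = M} M-model σ (states k) j)
                         , refl }

    -- The reflected path has the same states and actions, so π′ is an
    -- outcome of σ in M by the very same proof.
    reflect-outcome : ∀ {M M′ : Model ns m} (M⊑M′ : M ⊑[ Γ ] M′) (σ : JStrat M Γ) {g : St ns}
                      (π′ : Path M′ g) → Out (transfer-strategy M⊑M′ σ) π′ → Path M g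
    reflect-outcome {M} M⊑M′ (σ , legal) π′ follows = record
      { state = state π′ ; action = action π′ ; start = start π′
      ; step  = λ k j → legal-in-M k j , proj₂ (step π′ k j) }
      where
      legal-in-M : (k : ℕ) (j : Fin n) → tb M j (comp (state π′ k) j) (comp (action π′ k) j) ≡ true
      legal-in-M k j with j ∈? Γ
      ... | yes j∈Γ = subst (λ a → tb M j _ a ≡ true) (sym (follows k j j∈Γ)) (legal j j∈Γ (state π′ k))
      ... | no  j∉Γ = tb-⊆ (opponents-⊇ M⊑M′ j j∉Γ) _ _ (proj₁ (step π′ k j))

    module _ {M M′ : Model ns m} (M′-model : IsModel M′) (M⊑M′ : M ⊑[ Γ ] M′) where

      X-mono : ∀ {φ φ′} → solve φ M ⊆S solve φ′ M′ → solve (⟪ Γ ⟫X φ) M ⊆S solve (⟪ Γ ⟫X φ′) M′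
      X-mono φ⊆ g (σ , _ , wins) =
        σ′ , outcome-nonempty M′-model σ′ g , λ π′ o → φ⊆ _ (wins (reflect-outcome M⊑M′ σ π′ o) o)
        where σ′ = transfer-strategy M⊑M′ σ

      G-mono : ∀ {φ φ′} → solve φ M ⊆S solve φ′ M′ → solve (⟪ Γ ⟫G φ) M ⊆S solve (⟪ Γ ⟫G φ′) M′
      G-mono φ⊆ g (σ , _ , wins) =
        σ′ , outcome-nonempty M′-model σ′ g , λ π′ o k → φ⊆ _ (wins (reflect-outcome M⊑M′ σ π′ o) o k)
        where σ′ = transfer-strategy M⊑M′ σ

      U-mono : ∀ {φ φ′ ψ ψ′} → solve φ M ⊆S solve φ′ M′ → solve ψ M ⊆S solve ψ′ M′ →
               solve (⟪ Γ ⟫ φ U ψ) M ⊆S solve (⟪ Γ ⟫ φ′ U ψ′) M′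
      U-mono φ⊆ ψ⊆ g (σ , _ , wins) =
        σ′ , outcome-nonempty M′-model σ′ g , λ π′ o →
          let (i , ψᵢ , φ<ᵢ) = wins (reflect-outcome M⊑M′ σ π′ o) o
          in  i , ψ⊆ _ ψᵢ , λ j j<i → φ⊆ _ (φ<ᵢ j j<i)
        where σ′ = transfer-strategy M⊑M′ σ

  module _ {M M′ : Model ns m} {g : St ns} {p : Fin m} where

    VBFlip⇒⊑ : ∀ {Γ b} → VBFlip M M′ g p b → M ⊑[ Γ ] M′
    VBFlip⇒⊑ (_ , _ , same , _) = mk⊑ (λ j _ → proj₁ (protocols-agree⇒⊆ᴾ (same j)))
                                      (λ j _ → proj₂ (protocols-agree⇒⊆ᴾ (same j)))

    VBFlip-false⇒⊆ⱽ : VBFlip M M′ g p false → M ⊆ⱽ M′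
    VBFlip-false⇒⊆ⱽ (_ , _ , _ , was , _ , same) = mk⊆ⱽ (update-at-false-keeps-true (vb M) (vb M′) was same)

    VBFlip-true⇒⊇ⱽ : VBFlip M M′ g p true → M′ ⊆ⱽ M
    VBFlip-true⇒⊇ⱽ (_ , _ , _ , _ , now , same) =
      mk⊆ⱽ (update-at-false-keeps-true (vb M′) (vb M) now (λ h r ¬at → sym (same h r ¬at)))

    VBFlip-false⇒Improves : ∀ {Γ} → VBFlip M M′ g p false → Improves Γ M M′
    VBFlip-false⇒Improves F@(_ , M′-model , _) = mkImproves M′-model (VBFlip⇒⊑ F) (VBFlip-false⇒⊆ⱽ F)

  module _ {M M′ : Model ns m} {i : Fin n} {l a : Fin (lookup ns i)} where

    TBFlip⇒⊆ⱽ : ∀ {b} → TBFlip M M′ i l a b → M ⊆ⱽ M′ × M′ ⊆ⱽ M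
    TBFlip⇒⊆ⱽ (_ , _ , _ , _ , _ , _ , same) = valuations-agree⇒⊆ⱽ same

    TBFlip-others : ∀ {b j} → TBFlip M M′ i l a b → j ≢ i → M ⊆ᴾ[ j ] M′ × M′ ⊆ᴾ[ j ] M
    TBFlip-others (_ , _ , others , _) j≢i = protocols-agree⇒⊆ᴾ (others _ j≢i)

    TBFlip-false⇒⊆ᴾ : TBFlip M M′ i l a false → (j : Fin n) → M ⊆ᴾ[ j ] M′
    TBFlip-false⇒⊆ᴾ F@(_ , _ , _ , same , was , _) j with j ≟ i
    ... | no  j≢i  = proj₁ (TBFlip-others F j≢i)
    ... | yes refl = mk⊆ᴾ (update-at-false-keeps-true (tb M i) (tb M′ i) was same)

    TBFlip-true⇒⊇ᴾ : TBFlip M M′ i l a true → (j : Fin n) → M′ ⊆ᴾ[ j ] M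
    TBFlip-true⇒⊇ᴾ F@(_ , _ , _ , same , _ , now , _) j with j ≟ i
    ... | no  j≢i  = proj₂ (TBFlip-others F j≢i)
    ... | yes refl = mk⊆ᴾ (update-at-false-keeps-true (tb M′ i) (tb M i) now (λ l′ a′ ¬at → sym (same l′ a′ ¬at)))

    TBFlip-false⇒Improves : ∀ {Γ} → i ∈ Γ → TBFlip M M′ i l a false → Improves Γ M M′
    TBFlip-false⇒Improves i∈Γ F@(_ , M′-model , _) = mkImproves M′-model
      (mk⊑ (λ j _ → TBFlip-false⇒⊆ᴾ F j) (λ j j∉Γ → proj₂ (TBFlip-others F (λ { refl → j∉Γ i∈Γ }))))
      (proj₁ (TBFlip⇒⊆ⱽ F))

    TBFlip-true⇒Improves : ∀ {Γ} → i ∉ Γ → TBFlip M M′ i l a true → Improves Γ M M′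
    TBFlip-true⇒Improves i∉Γ F@(_ , M′-model , _) = mkImproves M′-model
      (mk⊑ (λ j j∈Γ → proj₁ (TBFlip-others F (λ { refl → i∉Γ j∈Γ }))) (λ j _ → TBFlip-true⇒⊇ᴾ F j))
      (proj₁ (TBFlip⇒⊆ⱽ F))

theorem3p8 : (n : ℕ) (ns : Vec ℕ n) (m : ℕ) (p q : Fin m) (Γ : Subset n) →
    (PosMonoVB ns (var p) × PosMonoVB ns (var p ∧' var q) ×
    PosMonoVB ns (⟪ Γ ⟫X var p) × PosMonoVB ns (⟪ Γ ⟫G var p) ×
    PosMonoVB ns (⟪ Γ ⟫ var p U var q))
    × NegMonoVB ns (¬' var p)
    × ((i : Fin n) →
    (PosMonoTB ns (var p) i × NegMonoTB ns (var p) i) ×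
    (PosMonoTB ns (¬' var p) i × NegMonoTB ns (¬' var p) i) ×
    (PosMonoTB ns (var p ∧' var q) i × NegMonoTB ns (var p ∧' var q) i))
    × ((i : Fin n) → i ∈ Γ →
    PosMonoTB ns (⟪ Γ ⟫X var p) i × PosMonoTB ns (⟪ Γ ⟫G var p) i ×
    PosMonoTB ns (⟪ Γ ⟫ var p U var q) i)
    × ((i : Fin n) → i ∉ Γ →
    NegMonoTB ns (⟪ Γ ⟫X var p) i × NegMonoTB ns (⟪ Γ ⟫G var p) i ×
    NegMonoTB ns (⟪ Γ ⟫ var p U var q) i)
theorem3p8 n ns m p q Γ =
    ( (λ _ _ _ _ F → atom (VBFlip-false⇒⊆ⱽ F))
    , (λ _ _ _ _ F → conjunction (VBFlip-false⇒⊆ⱽ F))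
    , (λ _ _ _ _ F → next (VBFlip-false⇒Improves F))
    , (λ _ _ _ _ F → always (VBFlip-false⇒Improves F))
    , (λ _ _ _ _ F → until (VBFlip-false⇒Improves F)))
  , (λ _ _ _ _ F → negation (VBFlip-true⇒⊇ⱽ F))
  , (λ i → ((λ _ _ _ _ F → atom (proj₁ (TBFlip⇒⊆ⱽ F))) , (λ _ _ _ _ F → atom (proj₁ (TBFlip⇒⊆ⱽ F))))
         , ((λ _ _ _ _ F → negation (proj₂ (TBFlip⇒⊆ⱽ F))) , (λ _ _ _ _ F → negation (proj₂ (TBFlip⇒⊆ⱽ F))))
         , ((λ _ _ _ _ F → conjunction (proj₁ (TBFlip⇒⊆ⱽ F))) , (λ _ _ _ _ F → conjunction (proj₁ (TBFlip⇒⊆ⱽ F)))))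
  , (λ i i∈Γ → (λ _ _ _ _ F → next (TBFlip-false⇒Improves i∈Γ F))
             , (λ _ _ _ _ F → always (TBFlip-false⇒Improves i∈Γ F))
             , (λ _ _ _ _ F → until (TBFlip-false⇒Improves i∈Γ F)))
  , (λ i i∉Γ → (λ _ _ _ _ F → next (TBFlip-true⇒Improves i∉Γ F))
             , (λ _ _ _ _ F → always (TBFlip-true⇒Improves i∉Γ F))
             , (λ _ _ _ _ F → until (TBFlip-true⇒Improves i∉Γ F)))
  where
  module _ {M M′ : Model ns m} where
    atom : M ⊆ⱽ M′ → solve (var p) M ⊆S solve (var p) M′
    atom = var-mono

    negation : M′ ⊆ⱽ M → solve (¬' var p) M ⊆S solve (¬' var p) M′
    negation M′⊆M = ¬-antitone {M = M} {M′} (var-mono {p = p} M′⊆M)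

    conjunction : M ⊆ⱽ M′ → solve (var p ∧' var q) M ⊆S solve (var p ∧' var q) M′
    conjunction M⊆M′ = ∧-mono {M = M} {M′} (var-mono {p = p} M⊆M′) (var-mono {p = q} M⊆M′)

    next : Improves Γ M M′ → solve (⟪ Γ ⟫X var p) M ⊆S solve (⟪ Γ ⟫X var p) M′
    next (mkImproves M′-model M⊑M′ M⊆M′) = X-mono M′-model M⊑M′ (var-mono M⊆M′)

    always : Improves Γ M M′ → solve (⟪ Γ ⟫G var p) M ⊆S solve (⟪ Γ ⟫G var p) M′
    always (mkImproves M′-model M⊑M′ M⊆M′) = G-mono M′-model M⊑M′ (var-mono M⊆M′)

    until : Improves Γ M M′ → solve (⟪ Γ ⟫ var p U var q) M ⊆S solve (⟪ Γ ⟫ var p U var q) M′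
    until (mkImproves M′-model M⊑M′ M⊆M′) = U-mono M′-model M⊑M′ (var-mono M⊆M′) (var-mono M⊆M′)
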